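{- Let $d$ be a degree sequence, let $R$ be a labeled realization of $d$, and let $n\ge 4$. Then $R$ belongs to a clique of size $n$ in the realization graph $\mathcal{G}(d)$ if and only if $R$ contains the configuration $\mathcal{D}_n$. Furthermore, in this case, for such a clique, moving in $\mathcal{G}(d)$ from $R$ to another vertex of the clique corresponds precisely to performing a 2-switch on an alternating 4-cycle all of whose edges and non-edges belong to (the image of) the configuration $\mathcal{D}_n$ in $R$.
   Context: All graphs are finite and simple. A labeled realization of a degree sequence $d=(d_1,\dots,d_n)$ is a graph on the fixed vertex set $\{v_1,\dots,v_n\}$ in which $v_i$ has degree $d_i$. An alternating 4-cycle $[u,v:w,x]$ in a graph $H$ consists of four distinct vertices $u,v,w,x$ with $uv,wx\in E(H)$ and $ux,vw\notin E(H)$ (nothing is required of the pairs $\{u,w\},\{v,x\}$). A 2-switch on it deletes $uv,wx$ and adds $ux,vw$. The realization graph $\mathcal{G}(d)$ has the labeled realizations of $d$ as vertices, two being adjacent when one is obtained from the other by a single 2-switch. A configuration is a triple $(W,F,F')$ where $W$ is a set and $F,F'$ are disjoint sets of 2-element subsets of $W$; a graph $H$ contains it if there is an injective map $f:W\to V(H)$ sending each pair of $F$ to an edge of $H$ and each pair of $F'$ to a non-edge of $H$ (no condition on other pairs). $\mathcal{D}_n$ is the configuration with $n+2$ vertices $u,v,w_1,\dots,w_n$, edges $F=\{uw_1\}\cup\{vw_i: 2\le i\le n\}$ and non-edges $F'=\{vw_1\}\cup\{uw_i:2\le i\le n\}$. -}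

module Defs where

open import Data.Nat using (ℕ; zero; suc; _+_)
open import Data.Bool using (Bool; true; false; if_then_else_; _∧_; _∨_)
open import Data.Fin using (Fin; zero; suc; _≟_)
open import Data.Vec using (Vec; []; _∷_; lookup; tabulate)
open import Data.List using (List; map; allFin)
open import Data.List.Relation.Unary.Any using (Any)
open import Data.List.Relation.Unary.All using (All)
open import Data.Product using (_×_; _,_; proj₁; proj₂; Σ; ∃; ∃-syntax)
open import Data.Sum using (_⊎_)
open import Relation.Nullary using (¬_)
open import Relation.Nullary.Decidable using (⌊_⌋)
open import Relation.Binary.PropositionalEquality using (_≡_; _≢_)

-- A graph on the labeled vertex set {v_1..v_m} ≅ Fin m, given by its
-- adjacency matrix.  Simplicity is imposed by 'IsSimple'.
Mat : ℕ → Set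
Mat m = Vec (Vec Bool m) m

entry : ∀ {m} → Mat m → Fin m → Fin m → Bool
entry A i j = lookup (lookup A i) j

E : ∀ {m} → Mat m → Fin m → Fin m → Set
E A i j = entry A i j ≡ true

NE : ∀ {m} → Mat m → Fin m → Fin m → Set
NE A i j = entry A i j ≡ false

IsSimple : ∀ {m} → Mat m → Set
IsSimple A = (∀ i j → entry A i j ≡ entry A j i) × (∀ i → NE A i i)

countTrue : ∀ {k} → Vec Bool k → ℕ
countTrue [] = 0
countTrue (true ∷ bs) = suc (countTrue bs)
countTrue (false ∷ bs) = countTrue bs

degree : ∀ {m} → Mat m → Fin m → ℕ
degree A i = countTrue (lookup A i)

Realization : ∀ {m} → Vec ℕ m → Mat m → Set
Realization d A = IsSimple A × (∀ i → degree A i ≡ lookup d i)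

Distinct4 : ∀ {m} → Fin m → Fin m → Fin m → Fin m → Set
Distinct4 u v w x =
  u ≢ v × u ≢ w × u ≢ x × v ≢ w × v ≢ x × w ≢ x

Alt : ∀ {m} → Mat m → Fin m → Fin m → Fin m → Fin m → Set
Alt A u v w x = Distinct4 u v w x × E A u v × E A w x × NE A u x × NE A v w

samePair : ∀ {m} → Fin m → Fin m → Fin m → Fin m → Bool
samePair i j a b = (⌊ i ≟ a ⌋ ∧ ⌊ j ≟ b ⌋) ∨ (⌊ i ≟ b ⌋ ∧ ⌊ j ≟ a ⌋)

switch : ∀ {m} → Mat m → Fin m → Fin m → Fin m → Fin m → Mat m
switch A u v w x = tabulate λ i → tabulate λ j →
  if samePair i j u v ∨ samePair i j w x then false
  else if samePair i j u x ∨ samePair i j v w then true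
  else entry A i j

SwitchStep : ∀ {m} → Mat m → Mat m → Set
SwitchStep A B = ∃[ u ] ∃[ v ] ∃[ w ] ∃[ x ] (Alt A u v w x × B ≡ switch A u v w x)

Adjacent : ∀ {m} → Mat m → Mat m → Set
Adjacent A B = SwitchStep A B ⊎ SwitchStep B A

IsClique : ∀ {m} → Vec ℕ m → (n : ℕ) → (Fin n → Mat m) → Set
IsClique d n K =
  (∀ i → Realization d (K i)) ×
  (∀ i j → i ≢ j → K i ≢ K j) ×
  (∀ i j → i ≢ j → Adjacent (K i) (K j))

InClique : ∀ {m} → Vec ℕ m → Mat m → ℕ → Set
InClique {m} d R n = Σ (Fin n → Mat m) λ K → IsClique d n K × ∃[ i ] (K i ≡ R)

-- Configurations (W,F,F') with W = Fin k; pairs given as ordered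
-- representatives of 2-element subsets.
record Config : Set where
  field
    k   : ℕ
    F   : List (Fin k × Fin k)
    F'  : List (Fin k × Fin k)

record Embedding {m} (A : Mat m) (C : Config) : Set where
  open Config C
  field
    f        : Fin k → Fin m
    inj      : ∀ a b → f a ≡ f b → a ≡ b
    edges    : All (λ p → E A (f (proj₁ p)) (f (proj₂ p))) F
    nonedges : All (λ p → NE A (f (proj₁ p)) (f (proj₂ p))) F'

Contains : ∀ {m} → Mat m → Config → Set
Contains A C = Embedding A C

-- The configuration D_n: vertices u = 0, v = 1, w_{i+1} = 2 + i (i : Fin n)
isZero : ∀ {n} → Fin n → Bool
isZero zero = true
isZero (suc _) = false

D : ℕ → Config
D n = record
  { k  = 2 + n
  ; F  = map (λ i → if isZero i then (u , w i) else (v , w i)) (allFin n)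
  ; F' = map (λ i → if isZero i then (v , w i) else (u , w i)) (allFin n)
  }
  where
  u v : Fin (2 + n)
  u = zero
  v = suc zero
  w : Fin n → Fin (2 + n)
  w i = suc (suc i)

InImage : ∀ {m k} → (Fin k → Fin m) → List (Fin k × Fin k) → Fin m → Fin m → Set
InImage f P a b =
  Any (λ p → (f (proj₁ p) ≡ a × f (proj₂ p) ≡ b) ⊎ (f (proj₁ p) ≡ b × f (proj₂ p) ≡ a)) P

SwitchWithin : ∀ {m} {A : Mat m} {C : Config} → Embedding A C → Mat m → Set
SwitchWithin {A = A} {C} e B =
  ∃[ u ] ∃[ v ] ∃[ w ] ∃[ x ]
    ( Alt A u v w x
    × InImage (Embedding.f e) (Config.F C) u v
    × InImage (Embedding.f e) (Config.F C) w x
    × InImage (Embedding.f e) (Config.F' C) u x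
    × InImage (Embedding.f e) (Config.F' C) v w
    × B ≡ switch A u v w x )

-- A 2-switch on [u,v:w,x] adds the 4-cycle u v w x to the adjacency matrix over 𝔽₂. So the
-- neighbours of R in 𝒢(d) are the R + C for alternating 4-cycles C of R, and R + C, R + C′ are
-- adjacent exactly when C + C′ is again a 4-cycle, i.e. when C and C′ share exactly two sides.
-- If three alternating 4-cycles pairwise share two sides, the shared sides are never opposite
-- ones (otherwise the third cycle would contain a claw, a triangle, or a corner whose two sides
-- are both edges or both non-edges of R), so all of them contain one path u – w – v with uw ∈ R
-- and wv ∉ R. A clique of size n ≥ 4 through R therefore consists of R and the switches on
-- [u,w:v,x] for n − 1 vertices x, which is precisely a copy of 𝒟ₙ with w₁ ↦ w; conversely the
-- switches on [u,w:v,x] and [u,w:v,x′] differ by the switch on [u,x:v,x′].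
module Submission where

open import Defs
open import Data.Nat using (ℕ; zero; suc; _+_; _≤_; s≤s; z≤n)
open import Data.Fin using (Fin; zero; suc; #_; _≟_; punchIn; punchOut)
open import Data.Fin.Properties using (suc-injective; punchIn-injective; punchInᵢ≢i; punchIn-punchOut)
open import Data.Vec using (Vec; _∷_; lookup)
open import Data.Vec.Functional using () renaming (_∷_ to _∷ᶠ_)
open import Data.Vec.Properties using (lookup∘tabulate; tabulate∘lookup; tabulate-cong)
open import Data.Bool using (Bool; true; false; not; _xor_; _∨_; _∧_; if_then_else_)
open import Data.Bool.Properties
  using (∧-comm; ∨-comm; xor-assoc; xor-same; xor-identityʳ; not-involutive; ¬-not; xor-∧-commutativeRing)
open import Data.Product using (_×_; _,_; proj₁; proj₂; Σ; ∃-syntax; map₂)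
open import Data.Sum using (_⊎_; inj₁; inj₂; swap)
open import Data.Empty using (⊥; ⊥-elim)
open import Data.List using (map; allFin)
open import Data.List.Relation.Unary.All using (All)
open import Data.List.Relation.Unary.Any using (Any)
import Data.List.Relation.Unary.All.Properties as Allₚ
import Data.List.Relation.Unary.Any.Properties as Anyₚ
open import Algebra.Bundles using (CommutativeRing)
open import Relation.Nullary using (¬_; yes; no)
open import Relation.Nullary.Decidable using (⌊_⌋; decidable-stable)
open import Relation.Binary.PropositionalEquality
open import Function.Base using (_∘_)
open import Function.Bundles using (_⇔_; mk⇔)

open CommutativeRing xor-∧-commutativeRing using (+-commutativeMonoid)
open import Algebra.Solver.CommutativeMonoid +-commutativeMonoid using (solve; _⊜_; _⊕_)

private
  variable
    m : ℕ
    a b c d e i j k p q r s a′ b′ c′ d′ : Fin m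

≟-refl : (a : Fin m) → ⌊ a ≟ a ⌋ ≡ true
≟-refl a with a ≟ a
... | yes _ = refl
... | no a≢a = ⊥-elim (a≢a refl)

≟-≢ : a ≢ b → ⌊ a ≟ b ⌋ ≡ false
≟-≢ {a = a} {b} a≢b with a ≟ b
... | yes a≡b = ⊥-elim (a≢b a≡b)
... | no _ = refl

≟-true : ⌊ a ≟ b ⌋ ≡ true → a ≡ b
≟-true {a = a} {b} h with a ≟ b
... | yes a≡b = a≡b

samePair-refl : (a b : Fin m) → samePair a b a b ≡ true
samePair-refl a b rewrite ≟-refl a | ≟-refl b = refl

samePair-comm : (i j a b : Fin m) → samePair i j a b ≡ samePair i j b a
samePair-comm i j a b = ∨-comm (⌊ i ≟ a ⌋ ∧ ⌊ j ≟ b ⌋) (⌊ i ≟ b ⌋ ∧ ⌊ j ≟ a ⌋)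

samePair-sym : (i j a b : Fin m) → samePair i j a b ≡ samePair j i a b
samePair-sym i j a b =
  trans (∨-comm (⌊ i ≟ a ⌋ ∧ ⌊ j ≟ b ⌋) _)
        (cong₂ _∨_ (∧-comm ⌊ i ≟ b ⌋ ⌊ j ≟ a ⌋) (∧-comm ⌊ i ≟ a ⌋ ⌊ j ≟ b ⌋))

samePair-true : samePair i j a b ≡ true → (i ≡ a × j ≡ b) ⊎ (i ≡ b × j ≡ a)
samePair-true {i = i} {j} {a} {b} h with ⌊ i ≟ a ⌋ in ia | ⌊ j ≟ b ⌋ in jb
... | true | true = inj₁ (≟-true ia , ≟-true jb)
samePair-true {i = i} {j} {a} {b} h | true | false with ⌊ i ≟ b ⌋ in ib | ⌊ j ≟ a ⌋ in ja
... | true | true = inj₂ (≟-true ib , ≟-true ja)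
samePair-true {i = i} {j} {a} {b} h | false | _ with ⌊ i ≟ b ⌋ in ib | ⌊ j ≟ a ⌋ in ja
... | true | true = inj₂ (≟-true ib , ≟-true ja)

samePair-avoid : i ≢ a → i ≢ b → samePair i j a b ≡ false
samePair-avoid i≢a i≢b rewrite ≟-≢ i≢a | ≟-≢ i≢b = refl

samePair-loop : a ≢ b → (i : Fin m) → samePair i i a b ≡ false
samePair-loop {a = a} {b} a≢b i with i ≟ a | i ≟ b
... | yes refl | yes refl = ⊥-elim (a≢b refl)
... | yes _ | no _ = refl
... | no _ | yes _ = refl
... | no _ | no _ = refl

-- 4-cycles as symmetric edge indicators

_≐_ : (F G : Fin m → Fin m → Bool) → Set
F ≐ G = ∀ i j → F i j ≡ G i j

opaque
  cycle : (p q r s : Fin m) → Fin m → Fin m → Bool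
  cycle p q r s i j = samePair i j p q xor samePair i j q r xor samePair i j r s xor samePair i j s p

  cycle-sym : (p q r s i j : Fin m) → cycle p q r s i j ≡ cycle p q r s j i
  cycle-sym p q r s i j =
    cong₂ _xor_ (samePair-sym i j p q) (cong₂ _xor_ (samePair-sym i j q r)
      (cong₂ _xor_ (samePair-sym i j r s) (samePair-sym i j s p)))

  cycle-rotate : (p q r s : Fin m) → cycle p q r s ≐ cycle q r s p
  cycle-rotate p q r s i j =
    solve 4 (λ x y z w → x ⊕ (y ⊕ (z ⊕ w)) ⊜ y ⊕ (z ⊕ (w ⊕ x))) refl
      (samePair i j p q) (samePair i j q r) (samePair i j r s) (samePair i j s p)

  cycle-reflect : (p q r s : Fin m) → cycle p q r s ≐ cycle p s r q
  cycle-reflect p q r s i j = begin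
    samePair i j p q xor samePair i j q r xor samePair i j r s xor samePair i j s p
      ≡⟨ solve 4 (λ x y z w → x ⊕ (y ⊕ (z ⊕ w)) ⊜ w ⊕ (z ⊕ (y ⊕ x))) refl
           (samePair i j p q) (samePair i j q r) (samePair i j r s) (samePair i j s p) ⟩
    samePair i j s p xor samePair i j r s xor samePair i j q r xor samePair i j p q
      ≡⟨ cong₂ _xor_ (samePair-comm i j s p) (cong₂ _xor_ (samePair-comm i j r s)
           (cong₂ _xor_ (samePair-comm i j q r) (samePair-comm i j p q))) ⟩
    samePair i j p s xor samePair i j s r xor samePair i j r q xor samePair i j q p ∎
    where open ≡-Reasoning

  cycle-glue : (u w v y y′ : Fin m) → cycle u w v y′ ≐ λ i j → cycle u y v y′ i j xor cycle u w v y i j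
  cycle-glue {m} u w v y y′ i j = sym (begin
    (uy xor yv xor vy′ xor y′u) xor (uw xor wv xor vy xor yu)
      ≡⟨ cong₂ (λ x z → (uy xor x xor vy′ xor y′u) xor (uw xor wv xor vy xor z))
               (samePair-comm i j y v) (samePair-comm i j y u) ⟩
    (uy xor vy xor vy′ xor y′u) xor (uw xor wv xor vy xor uy)
      ≡⟨ solve 6 (λ uy vy vy′ y′u uw wv →
           (uy ⊕ (vy ⊕ (vy′ ⊕ y′u))) ⊕ (uw ⊕ (wv ⊕ (vy ⊕ uy))) ⊜
           (uw ⊕ (wv ⊕ (vy′ ⊕ y′u))) ⊕ ((vy ⊕ vy) ⊕ (uy ⊕ uy))) refl uy vy vy′ y′u uw wv ⟩
    (uw xor wv xor vy′ xor y′u) xor ((vy xor vy) xor (uy xor uy))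
      ≡⟨ cong ((uw xor wv xor vy′ xor y′u) xor_) (cong₂ _xor_ (xor-same vy) (xor-same uy)) ⟩
    (uw xor wv xor vy′ xor y′u) xor false
      ≡⟨ xor-identityʳ _ ⟩
    uw xor wv xor vy′ xor y′u ∎)
    where
    open ≡-Reasoning
    uw wv vy′ y′u uy yv vy yu : Bool
    uw = samePair i j u w
    wv = samePair i j w v
    vy′ = samePair i j v y′
    y′u = samePair i j y′ u
    uy = samePair i j u y
    yv = samePair i j y v
    vy = samePair i j v y
    yu = samePair i j y u

data Dihedral (p q r s : Fin m) : Fin m → Fin m → Fin m → Fin m → Set where
  rot₀ : Dihedral p q r s p q r s
  rot₁ : Dihedral p q r s q r s p
  rot₂ : Dihedral p q r s r s p q
  rot₃ : Dihedral p q r s s p q r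
  ref₀ : Dihedral p q r s p s r q
  ref₁ : Dihedral p q r s q p s r
  ref₂ : Dihedral p q r s r q p s
  ref₃ : Dihedral p q r s s r q p

dihedral-transport : (P : Fin m → Fin m → Fin m → Fin m → Set) →
  (∀ {p q r s} → P p q r s → P q r s p) → (∀ {p q r s} → P p q r s → P p s r q) →
  Dihedral p q r s a b c d → P p q r s → P a b c d
dihedral-transport P ρ σ rot₀ = λ x → x
dihedral-transport P ρ σ rot₁ = ρ
dihedral-transport P ρ σ rot₂ = λ x → ρ (ρ x)
dihedral-transport P ρ σ rot₃ = λ x → ρ (ρ (ρ x))
dihedral-transport P ρ σ ref₀ = σ
dihedral-transport P ρ σ ref₁ = λ x → σ (ρ x)
dihedral-transport P ρ σ ref₂ = λ x → σ (ρ (ρ x))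
dihedral-transport P ρ σ ref₃ = λ x → σ (ρ (ρ (ρ x)))

cycle-dihedral : Dihedral p q r s a b c d → cycle p q r s ≐ cycle a b c d
cycle-dihedral {p = p} {q} {r} {s} δ =
  dihedral-transport (λ a b c d → cycle p q r s ≐ cycle a b c d)
    (λ {a} {b} {c} {d} h i j → trans (h i j) (cycle-rotate a b c d i j))
    (λ {a} {b} {c} {d} h i j → trans (h i j) (cycle-reflect a b c d i j))
    δ (λ _ _ → refl)

distinct-dihedral : Dihedral p q r s a b c d → Distinct4 p q r s → Distinct4 a b c d
distinct-dihedral δ = dihedral-transport Distinct4
  (λ (p≢q , p≢r , p≢s , q≢r , q≢s , r≢s) → q≢r , q≢s , ≢-sym p≢q , r≢s , ≢-sym p≢r , ≢-sym p≢s)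
  (λ (p≢q , p≢r , p≢s , q≢r , q≢s , r≢s) → p≢s , p≢r , p≢q , ≢-sym r≢s , ≢-sym q≢s , ≢-sym q≢r)
  δ

data Side (p q r s : Fin m) : Fin m → Fin m → Set where
  pq : Side p q r s p q
  qp : Side p q r s q p
  qr : Side p q r s q r
  rq : Side p q r s r q
  rs : Side p q r s r s
  sr : Side p q r s s r
  sp : Side p q r s s p
  ps : Side p q r s p s

oriented : Side p q r s a b → Side p q r s b a → (i ≡ a × j ≡ b) ⊎ (i ≡ b × j ≡ a) → Side p q r s i j
oriented σ _ (inj₁ (refl , refl)) = σ
oriented _ σ′ (inj₂ (refl , refl)) = σ′

side-dihedral : Side p q r s i j → ∃[ c ] ∃[ d ] Dihedral p q r s i j c d
side-dihedral pq = _ , _ , rot₀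
side-dihedral qp = _ , _ , ref₁
side-dihedral qr = _ , _ , rot₁
side-dihedral rq = _ , _ , ref₂
side-dihedral rs = _ , _ , rot₂
side-dihedral sr = _ , _ , ref₃
side-dihedral sp = _ , _ , rot₃
side-dihedral ps = _ , _ , ref₀

xor4-true : ∀ {x y z w} → x xor y xor z xor w ≡ true → x ≡ true ⊎ y ≡ true ⊎ z ≡ true ⊎ w ≡ true
xor4-true {true} _ = inj₁ refl
xor4-true {false} {true} _ = inj₂ (inj₁ refl)
xor4-true {false} {false} {true} _ = inj₂ (inj₂ (inj₁ refl))
xor4-true {false} {false} {false} {true} _ = inj₂ (inj₂ (inj₂ refl))

opaque
  unfolding cycle

  cycle-side : cycle p q r s i j ≡ true → Side p q r s i j
  cycle-side {p = p} {q} {r} {s} {i} {j} h with xor4-true h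
  ... | inj₁ h′ = oriented pq qp (samePair-true {i = i} {j} {p} {q} h′)
  ... | inj₂ (inj₁ h′) = oriented qr rq (samePair-true {i = i} {j} {q} {r} h′)
  ... | inj₂ (inj₂ (inj₁ h′)) = oriented rs sr (samePair-true {i = i} {j} {r} {s} h′)
  ... | inj₂ (inj₂ (inj₂ h′)) = oriented sp ps (samePair-true {i = i} {j} {s} {p} h′)

  cycle-first : Distinct4 p q r s → cycle p q r s p q ≡ true
  cycle-first {p = p} {q} {r} {s} (p≢q , p≢r , p≢s , q≢r , q≢s , r≢s)
    rewrite samePair-refl p q | samePair-avoid {j = q} p≢q p≢r | samePair-avoid {j = q} p≢r p≢s
          | samePair-sym p q s p | samePair-avoid {j = p} q≢s (≢-sym p≢q) = refl

side-cycle : Distinct4 p q r s → Side p q r s i j → cycle p q r s i j ≡ true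
side-cycle dist σ = let (_ , _ , δ) = side-dihedral σ in
  trans (cycle-dihedral δ _ _) (cycle-first (distinct-dihedral δ dist))

cycle-flip : ∀ {v} → cycle p q r s i j ≡ v → cycle p q r s j i ≡ v
cycle-flip {p = p} {q = q} {r = r} {s = s} {i = i} {j = j} h = trans (cycle-sym p q r s j i) h

dihedral-edge : Dihedral p q r s a b c d → cycle p q r s i j ≡ true → cycle a b c d i j ≡ true
dihedral-edge {i = i} {j} δ h = trans (sym (cycle-dihedral δ i j)) h

Corner : (p q r s i : Fin m) → Set
Corner p q r s i = i ≡ p ⊎ i ≡ q ⊎ i ≡ r ⊎ i ≡ s

corner-avoid : i ≢ p → i ≢ q → i ≢ r → i ≢ s → ¬ Corner p q r s i
corner-avoid i≢p _ _ _ (inj₁ i≡p) = i≢p i≡p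
corner-avoid _ i≢q _ _ (inj₂ (inj₁ i≡q)) = i≢q i≡q
corner-avoid _ _ i≢r _ (inj₂ (inj₂ (inj₁ i≡r))) = i≢r i≡r
corner-avoid _ _ _ i≢s (inj₂ (inj₂ (inj₂ i≡s))) = i≢s i≡s

cycle-corner : cycle p q r s i j ≡ true → Corner p q r s i
cycle-corner h with cycle-side h
... | pq = inj₁ refl
... | qp = inj₂ (inj₁ refl)
... | qr = inj₂ (inj₁ refl)
... | rq = inj₂ (inj₂ (inj₁ refl))
... | rs = inj₂ (inj₂ (inj₁ refl))
... | sr = inj₂ (inj₂ (inj₂ refl))
... | sp = inj₂ (inj₂ (inj₂ refl))
... | ps = inj₁ refl

cycle-avoidʳ : ∀ {p q r s i j : Fin m} → j ≢ p → j ≢ q → j ≢ r → j ≢ s → cycle p q r s i j ≡ false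
cycle-avoidʳ {p = p} {q} {r} {s} {i} {j} j≢p j≢q j≢r j≢s with cycle p q r s i j in h
... | true = ⊥-elim (corner-avoid j≢p j≢q j≢r j≢s (cycle-corner (cycle-flip h)))
... | false = refl

cycle-avoidˡ : ∀ {p q r s i j : Fin m} → i ≢ p → i ≢ q → i ≢ r → i ≢ s → cycle p q r s i j ≡ false
cycle-avoidˡ {p = p} {q} {r} {s} {i} {j} i≢p i≢q i≢r i≢s =
  trans (cycle-sym p q r s i j) (cycle-avoidʳ i≢p i≢q i≢r i≢s)

cycle-from-edge : cycle p q r s a b ≡ true → ∃[ c ] ∃[ d ] Dihedral p q r s a b c d
cycle-from-edge = side-dihedral ∘ cycle-side

cycle-next : Distinct4 a b c d → cycle a b c d b e ≡ true → e ≢ a → c ≡ e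
cycle-next (a≢b , a≢c , a≢d , b≢c , b≢d , c≢d) h e≢a with cycle-side h
... | pq = ⊥-elim (a≢b refl)
... | qp = ⊥-elim (e≢a refl)
... | qr = refl
... | rq = ⊥-elim (b≢c refl)
... | rs = ⊥-elim (b≢c refl)
... | sr = ⊥-elim (b≢d refl)
... | sp = ⊥-elim (b≢d refl)
... | ps = ⊥-elim (a≢b refl)

cycle-prev : Distinct4 a b c d → cycle a b c d a e ≡ true → e ≢ b → d ≡ e
cycle-prev dist h e≢b = cycle-next (distinct-dihedral ref₁ dist) (dihedral-edge ref₁ h) e≢b

cycle-far : Distinct4 a b c d → cycle a b c d e k ≡ true → e ≢ a → e ≢ b → k ≢ a → k ≢ b →
  (c ≡ e × d ≡ k) ⊎ (c ≡ k × d ≡ e)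
cycle-far _ h e≢a e≢b k≢a k≢b with cycle-side h
... | pq = ⊥-elim (e≢a refl)
... | qp = ⊥-elim (e≢b refl)
... | qr = ⊥-elim (e≢b refl)
... | rq = ⊥-elim (k≢b refl)
... | rs = inj₁ (refl , refl)
... | sr = inj₂ (refl , refl)
... | sp = ⊥-elim (k≢a refl)
... | ps = ⊥-elim (e≢a refl)

cycle-path₂ : Distinct4 p q r s → cycle p q r s a b ≡ true → cycle p q r s b c ≡ true → c ≢ a →
  ∃[ e ] Dihedral p q r s a b c e
cycle-path₂ dist h₁ h₂ c≢a with cycle-from-edge h₁
... | _ , e , δ with cycle-next (distinct-dihedral δ dist) (dihedral-edge δ h₂) c≢a
... | refl = e , δ

cycle-path₃ : Distinct4 p q r s → cycle p q r s a b ≡ true → cycle p q r s b c ≡ true →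
  cycle p q r s c d ≡ true → c ≢ a → d ≢ b → Dihedral p q r s a b c d
cycle-path₃ dist h₁ h₂ h₃ c≢a d≢b with cycle-path₂ dist h₁ h₂ c≢a
... | e , δ with cycle-next (distinct-dihedral rot₁ (distinct-dihedral δ dist))
                         (dihedral-edge rot₁ (dihedral-edge δ h₃)) d≢b
... | refl = δ

cycle-opposite : Distinct4 a b c d → Distinct4 p q r s →
  cycle p q r s a b ≡ true → cycle p q r s c d ≡ true →
  Dihedral p q r s a b c d ⊎ Dihedral p q r s a b d c
cycle-opposite (a≢b , a≢c , a≢d , b≢c , b≢d , c≢d) dist h₁ h₂ with cycle-from-edge h₁
... | _ , _ , δ with cycle-far (distinct-dihedral δ dist) (dihedral-edge δ h₂)
                       (≢-sym a≢c) (≢-sym b≢c) (≢-sym a≢d) (≢-sym b≢d)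
...   | inj₁ (refl , refl) = inj₁ δ
...   | inj₂ (refl , refl) = inj₂ δ

cycle-opposite-corner : Distinct4 a b c d → Distinct4 p q r s → cycle p q r s a b ≡ true →
  cycle p q r s c d ≡ true → cycle p q r s i j ≡ true → Corner a b c d i
cycle-opposite-corner distA dist h₁ h₂ h with cycle-opposite distA dist h₁ h₂
... | inj₁ δ = cycle-corner (dihedral-edge δ h)
... | inj₂ δ with cycle-corner (dihedral-edge δ h)
...   | inj₁ i≡a = inj₁ i≡a
...   | inj₂ (inj₁ i≡b) = inj₂ (inj₁ i≡b)
...   | inj₂ (inj₂ (inj₁ i≡d)) = inj₂ (inj₂ (inj₂ i≡d))
...   | inj₂ (inj₂ (inj₂ i≡c)) = inj₂ (inj₂ (inj₁ i≡c))

cycle-no-claw : Distinct4 p q r s → cycle p q r s i a ≡ true → cycle p q r s i b ≡ true →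
  cycle p q r s i c ≡ true → a ≢ b → a ≢ c → b ≢ c → ⊥
cycle-no-claw dist h₁ h₂ h₃ a≢b a≢c b≢c with cycle-from-edge h₁
... | _ , _ , δ = b≢c (trans (sym (cycle-prev distδ (dihedral-edge δ h₂) (≢-sym a≢b)))
                             (cycle-prev distδ (dihedral-edge δ h₃) (≢-sym a≢c)))
  where distδ = distinct-dihedral δ dist

cycle-no-triangle : Distinct4 p q r s → cycle p q r s a b ≡ true → cycle p q r s b c ≡ true →
  cycle p q r s c a ≡ true → a ≢ b → a ≢ c → ⊥
cycle-no-triangle dist h₁ h₂ h₃ a≢b a≢c with cycle-path₂ dist h₁ h₂ (≢-sym a≢c)
... | e , δ with distinct-dihedral δ dist
...   | (_ , _ , a≢e , _ , _ , _) =
  a≢e (sym (cycle-next (distinct-dihedral rot₁ (distinct-dihedral δ dist))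
                       (dihedral-edge rot₁ (dihedral-edge δ h₃)) a≢b))

record Symmetric (R : Mat m) : Set where
  constructor symmetric
  field entry-sym : ∀ i j → entry R i j ≡ entry R j i

open Symmetric

true≢false : ∀ {x y} → x ≡ true → y ≡ false → x ≢ y
true≢false refl refl ()

x≢x-xor-true : ∀ {x} → x ≢ x xor true
x≢x-xor-true {true} ()
x≢x-xor-true {false} ()

false≡true-xor : ∀ {x} → false ≡ true xor x → x ≡ true
false≡true-xor {true} _ = refl

flip-value : ∀ {x y v} → x ≢ y → x ≡ v → y ≡ not v
flip-value x≢y refl = ¬-not (≢-sym x≢y)

record Alternating (R : Mat m) (p q r s : Fin m) : Set where
  constructor alternating
  field
    at-q : entry R p q ≢ entry R q r
    at-r : entry R q r ≢ entry R r s
    at-s : entry R r s ≢ entry R s p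
    at-p : entry R s p ≢ entry R p q

alternating-dihedral : {R : Mat m} → Symmetric R → Dihedral p q r s a b c d →
  Alternating R p q r s → Alternating R a b c d
alternating-dihedral {R = R} sym-R = dihedral-transport (Alternating R)
  (λ (alternating at-q at-r at-s at-p) → alternating at-r at-s at-p at-q)
  (λ {p} {q} {r} {s} (alternating at-q at-r at-s at-p) → alternating
    (subst₂ _≢_ (entry-sym sym-R s p) (entry-sym sym-R r s) (≢-sym at-s))
    (subst₂ _≢_ (entry-sym sym-R r s) (entry-sym sym-R q r) (≢-sym at-r))
    (subst₂ _≢_ (entry-sym sym-R q r) (entry-sym sym-R p q) (≢-sym at-q))
    (subst₂ _≢_ (entry-sym sym-R p q) (entry-sym sym-R s p) (≢-sym at-p)))

alt-rotate₂ : {R : Mat m} → Symmetric R → Alt R a b c d → Alt R c d a b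
alt-rotate₂ {a = a} {b} {c} {d} sym-R (dist , Eab , Ecd , Nad , Nbc) =
  distinct-dihedral rot₂ dist , Ecd , Eab , trans (entry-sym sym-R c b) Nbc , trans (entry-sym sym-R d a) Nad

alt-reflect : {R : Mat m} → Symmetric R → Alt R a b c d → Alt R b a d c
alt-reflect {a = a} {b} {c} {d} sym-R (dist , Eab , Ecd , Nad , Nbc) =
  distinct-dihedral ref₁ dist , trans (entry-sym sym-R b a) Eab , trans (entry-sym sym-R d c) Ecd , Nbc , Nad

alt⇒alternating : {R : Mat m} → Symmetric R → Alt R p q r s → Alternating R p q r s
alt⇒alternating {p = p} {s = s} {R} sym-R (_ , Epq , Ers , Nps , Nqr) =
  alternating (true≢false Epq Nqr) (≢-sym (true≢false Ers Nqr))
              (true≢false Ers Nsp) (≢-sym (true≢false Epq Nsp))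
  where
  Nsp : NE R s p
  Nsp = trans (entry-sym sym-R s p) Nps

alternating⇒alt : {R : Mat m} → Symmetric R → Distinct4 a b c d → Alternating R a b c d → E R a b →
  Alt R a b c d
alternating⇒alt {a = a} {b} {c} {d} {R} sym-R dist (alternating at-b at-c at-d at-a) Eab =
  dist , Eab , Ecd , trans (entry-sym sym-R a d) (flip-value at-d Ecd) , Nbc
  where
  Nbc : NE R b c
  Nbc = flip-value at-b Eab
  Ecd : E R c d
  Ecd = flip-value at-c Nbc

alternating-corner : {R : Mat m} → Symmetric R → Distinct4 p q r s → Alternating R p q r s →
  cycle p q r s i j ≡ true → cycle p q r s i k ≡ true → j ≢ k → entry R i j ≢ entry R i k
alternating-corner {i = i} {R = R} sym-R dist alt h₁ h₂ j≢k with cycle-from-edge h₁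
... | _ , e , δ with cycle-prev (distinct-dihedral δ dist) (dihedral-edge δ h₂) (≢-sym j≢k)
...   | refl = ≢-sym (subst (_≢ _) (entry-sym sym-R e i)
                              (Alternating.at-p (alternating-dihedral sym-R δ alt)))

-- Two alternating 4-cycles whose sum is a 4-cycle

record Linked (a b c d p q r s : Fin m) : Set where
  constructor linked
  field
    t₁ t₂ t₃ t₄ : Fin m
    distinct : Distinct4 t₁ t₂ t₃ t₄
    sum : ∀ i j → cycle p q r s i j ≡ cycle a b c d i j xor cycle t₁ t₂ t₃ t₄ i j

linked-congˡ : ∀ {a′ b′ c′ d′ : Fin m} → cycle a b c d ≐ cycle a′ b′ c′ d′ →
  Linked a b c d p q r s → Linked a′ b′ c′ d′ p q r s
linked-congˡ eq (linked t₁ t₂ t₃ t₄ dist sum) =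
  linked t₁ t₂ t₃ t₄ dist (λ i j → trans (sum i j) (cong (_xor _) (eq i j)))

data ExactlyTwo : Bool → Bool → Bool → Bool → Set where
  ttff : ExactlyTwo true true false false
  fttf : ExactlyTwo false true true false
  fftt : ExactlyTwo false false true true
  tfft : ExactlyTwo true false false true
  tftf : ExactlyTwo true false true false
  ftft : ExactlyTwo false true false true

three-sides-same : Distinct4 p q r s → Dihedral a b c d a′ b′ c′ d′ → Distinct4 a′ b′ c′ d′ →
  cycle p q r s a′ b′ ≡ true → cycle p q r s b′ c′ ≡ true → cycle p q r s c′ d′ ≡ true →
  cycle p q r s ≐ cycle a b c d
three-sides-same distS δ (a≢b , a≢c , a≢d , b≢c , b≢d , c≢d) h₁ h₂ h₃ i j =
  trans (cycle-dihedral (cycle-path₃ distS h₁ h₂ h₃ (≢-sym a≢c) (≢-sym b≢d)) i j)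
        (sym (cycle-dihedral δ i j))

module _ {a b c d p q r s : Fin m} (distA : Distinct4 a b c d) (distS : Distinct4 p q r s)
         (L : Linked a b c d p q r s) where
  open Linked L

  private
    S≢A : ¬ (cycle p q r s ≐ cycle a b c d)
    S≢A eq = x≢x-xor-true
      (trans (sym (eq t₁ t₂)) (trans (sum t₁ t₂) (cong (cycle a b c d t₁ t₂ xor_) (cycle-first distinct))))

    T≢A : ¬ (cycle t₁ t₂ t₃ t₄ ≐ cycle a b c d)
    T≢A eq with trans (sym (cycle-first distS))
                      (trans (sum p q) (trans (cong (cycle a b c d p q xor_) (eq p q)) (xor-same (cycle a b c d p q))))
    ... | ()

    inT : cycle p q r s i j ≡ false → cycle a b c d i j ≡ true → cycle t₁ t₂ t₃ t₄ i j ≡ true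
    inT {i = i} {j} S≡false A≡true =
      false≡true-xor (trans (sym S≡false) (trans (sum i j) (cong (_xor cycle t₁ t₂ t₃ t₄ i j) A≡true)))

    dist : Dihedral a b c d a′ b′ c′ d′ → Distinct4 a′ b′ c′ d′
    dist δ = distinct-dihedral δ distA

    ab : cycle a b c d a b ≡ true
    ab = side-cycle distA pq
    bc : cycle a b c d b c ≡ true
    bc = side-cycle distA qr
    cd : cycle a b c d c d ≡ true
    cd = side-cycle distA rs
    da : cycle a b c d d a ≡ true
    da = side-cycle distA sp

  linked-shared-sides :
    ExactlyTwo (cycle p q r s a b) (cycle p q r s b c) (cycle p q r s c d) (cycle p q r s d a)
  linked-shared-sides
    with cycle p q r s a b in e₁ | cycle p q r s b c in e₂ | cycle p q r s c d in e₃ | cycle p q r s d a in e₄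
  ... | true  | true  | true  | _     = ⊥-elim (S≢A (three-sides-same distS rot₀ distA e₁ e₂ e₃))
  ... | true  | true  | false | true  = ⊥-elim (S≢A (three-sides-same distS rot₃ (dist rot₃) e₄ e₁ e₂))
  ... | true  | true  | false | false = ttff
  ... | true  | false | true  | true  = ⊥-elim (S≢A (three-sides-same distS rot₂ (dist rot₂) e₃ e₄ e₁))
  ... | true  | false | true  | false = tftf
  ... | true  | false | false | true  = tfft
  ... | true  | false | false | false =
    ⊥-elim (T≢A (three-sides-same distinct rot₁ (dist rot₁) (inT e₂ bc) (inT e₃ cd) (inT e₄ da)))
  ... | false | true  | true  | true  = ⊥-elim (S≢A (three-sides-same distS rot₁ (dist rot₁) e₂ e₃ e₄))
  ... | false | true  | true  | false = fttf
  ... | false | true  | false | true  = ftft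
  ... | false | true  | false | false =
    ⊥-elim (T≢A (three-sides-same distinct rot₂ (dist rot₂) (inT e₃ cd) (inT e₄ da) (inT e₁ ab)))
  ... | false | false | true  | true  = fftt
  ... | false | false | true  | false =
    ⊥-elim (T≢A (three-sides-same distinct rot₃ (dist rot₃) (inT e₄ da) (inT e₁ ab) (inT e₂ bc)))
  ... | false | false | false | _     =
    ⊥-elim (T≢A (three-sides-same distinct rot₀ distA (inT e₁ ab) (inT e₂ bc) (inT e₃ cd)))

≢-≢⇒≡ : ∀ {x y z : Bool} → x ≢ y → x ≢ z → y ≡ z
≢-≢⇒≡ x≢y x≢z = trans (¬-not (≢-sym x≢y)) (sym (¬-not (≢-sym x≢z)))

crossed-linked-impossible : ∀ {R : Mat m} {a b c d p q r s : Fin m} → Symmetric R →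
  Distinct4 a b c d → Alternating R a b c d → Alternating R a b d c →
  Distinct4 p q r s → Alternating R p q r s → Linked a b c d p q r s → Linked a b d c p q r s → ⊥
crossed-linked-impossible {a = a} {b} {c} {d} {p} {q} {r} {s} sym-R
  distA@(a≢b , a≢c , a≢d , b≢c , b≢d , c≢d) altA altA′ distS altS L L′ = cases
  where
  distA′ : Distinct4 a b d c
  distA′ = a≢b , a≢d , a≢c , b≢d , b≢c , ≢-sym c≢d

  shared′ : ExactlyTwo (cycle p q r s a b) (cycle p q r s b d) (cycle p q r s c d) (cycle p q r s c a)
  shared′ = subst (λ x → ExactlyTwo (cycle p q r s a b) (cycle p q r s b d) x (cycle p q r s c a))
                  (cycle-sym p q r s d c) (linked-shared-sides distA′ distS L′)

  cases : ⊥
  cases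
    with cycle p q r s a b in e₁ | cycle p q r s b c in e₂ | cycle p q r s c d in e₃ | cycle p q r s d a in e₄
       | cycle p q r s b d in e₅ | cycle p q r s c a in e₆ | linked-shared-sides distA distS L | shared′
  ... | _ | _ | _ | _ | _ | _ | ttff | ttff = cycle-no-claw distS (cycle-flip e₁) e₂ e₅ a≢c a≢d c≢d
  ... | _ | _ | _ | _ | _ | _ | ttff | tfft = cycle-no-triangle distS e₁ e₂ e₆ a≢b a≢c
  ... | _ | _ | _ | _ | _ | _ | tftf | tftf with cycle-opposite distA distS e₁ e₃
  ...   | inj₁ δ = true≢false (trans (cycle-dihedral δ b c) (side-cycle distA qr)) e₂ refl
  ...   | inj₂ δ = true≢false (trans (cycle-dihedral δ b d) (side-cycle distA′ qr)) e₅ refl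
  cases | _ | _ | _ | _ | _ | _ | tfft | ttff = cycle-no-triangle distS e₁ e₅ e₄ a≢b a≢d
  cases | _ | _ | _ | _ | _ | _ | tfft | tfft =
    cycle-no-claw distS e₁ (cycle-flip e₄) (cycle-flip e₆) b≢d b≢c (≢-sym c≢d)
  cases | _ | _ | _ | _ | _ | _ | fttf | fttf = cycle-no-triangle distS e₂ e₃ (cycle-flip e₅) b≢c b≢d
  cases | _ | _ | _ | _ | _ | _ | fttf | fftt =
    cycle-no-claw distS (cycle-flip e₂) e₃ e₆ b≢d (≢-sym a≢b) (≢-sym a≢d)
  cases | _ | _ | _ | _ | _ | _ | ftft | ftft =
    alternating-corner sym-R distS altS e₂ e₅ c≢d
      (≢-≢⇒≡ (Alternating.at-q altA) (Alternating.at-q altA′))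
  cases | _ | _ | _ | _ | _ | _ | fftt | fttf =
    cycle-no-claw distS (cycle-flip e₃) e₄ (cycle-flip e₅) (≢-sym a≢c) (≢-sym b≢c) a≢b
  cases | _ | _ | _ | _ | _ | _ | fftt | fftt =
    cycle-no-triangle distS e₃ e₄ (cycle-flip e₆) c≢d (≢-sym a≢c)

linked-extends-path : ∀ {R : Mat m} {a b c d e p q r s : Fin m} → Symmetric R →
  Alt R a b c d → Alt R a b c e → d ≢ e →
  Distinct4 p q r s → Alternating R p q r s → Linked a b c d p q r s → Linked a b c e p q r s →
  ∃[ f ] Alt R a b c f × cycle p q r s ≐ cycle a b c f
linked-extends-path {R = R} {a} {b} {c} {d} {e} {p} {q} {r} {s} sym-R
  (distD@(a≢b , a≢c , a≢d , b≢c , b≢d , c≢d) , Eab , _ , Nad , Nbc)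
  (distE@(_ , _ , a≢e , _ , b≢e , c≢e) , _ , _ , Nae , _) d≢e distS altS L L′ = cases
  where
  distBCDA : Distinct4 b c d a
  distBCDA = distinct-dihedral rot₁ distD
  distBCEA : Distinct4 b c e a
  distBCEA = distinct-dihedral rot₁ distE

  e-avoids-abcd : ¬ Corner a b c d e
  e-avoids-abcd = corner-avoid (≢-sym a≢e) (≢-sym b≢e) (≢-sym c≢e) (≢-sym d≢e)
  d-avoids-abce : ¬ Corner a b c e d
  d-avoids-abce = corner-avoid (≢-sym a≢d) (≢-sym b≢d) (≢-sym c≢d) d≢e
  d-avoids-bcea : ¬ Corner b c e a d
  d-avoids-bcea = corner-avoid (≢-sym b≢d) (≢-sym c≢d) d≢e (≢-sym a≢d)
  e-avoids-bcda : ¬ Corner b c d a e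
  e-avoids-bcda = corner-avoid (≢-sym b≢e) (≢-sym c≢e) (≢-sym d≢e) (≢-sym a≢e)

  cases : ∃[ f ] Alt R a b c f × cycle p q r s ≐ cycle a b c f
  cases
    with cycle p q r s a b in e₁ | cycle p q r s b c in e₂ | cycle p q r s c d in e₃ | cycle p q r s d a in e₄
       | cycle p q r s c e in e₅ | cycle p q r s e a in e₆ | linked-shared-sides distD distS L
       | linked-shared-sides distE distS L′
  ... | _ | _ | _ | _ | _ | _ | ttff | ttff with cycle-path₂ distS e₁ e₂ (≢-sym a≢c)
  ...   | f , δ = f , alternating⇒alt sym-R (distinct-dihedral δ distS) (alternating-dihedral sym-R δ altS) Eab
                     , cycle-dihedral δ
  cases | _ | _ | _ | _ | _ | _ | tftf | tftf = ⊥-elim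
    (e-avoids-abcd (cycle-opposite-corner distD distS e₁ e₃ (cycle-flip e₅)))
  cases | _ | _ | _ | _ | _ | _ | tftf | tfft = ⊥-elim
    (e-avoids-abcd (cycle-opposite-corner distD distS e₁ e₃ e₆))
  cases | _ | _ | _ | _ | _ | _ | tfft | tftf = ⊥-elim
    (d-avoids-abce (cycle-opposite-corner distE distS e₁ e₅ e₄))
  cases | _ | _ | _ | _ | _ | _ | tfft | tfft = ⊥-elim
    (cycle-no-claw distS e₁ (cycle-flip e₄) (cycle-flip e₆) b≢d b≢e d≢e)
  cases | _ | _ | _ | _ | _ | _ | fttf | fttf = ⊥-elim
    (cycle-no-claw distS (cycle-flip e₂) e₃ e₅ b≢d b≢e d≢e)
  cases | _ | _ | _ | _ | _ | _ | fttf | ftft = ⊥-elim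
    (d-avoids-bcea (cycle-opposite-corner distBCEA distS e₂ e₆ (cycle-flip e₃)))
  cases | _ | _ | _ | _ | _ | _ | ftft | fttf = ⊥-elim
    (e-avoids-bcda (cycle-opposite-corner distBCDA distS e₂ e₄ (cycle-flip e₅)))
  cases | _ | _ | _ | _ | _ | _ | ftft | ftft = ⊥-elim
    (d-avoids-bcea (cycle-opposite-corner distBCEA distS e₂ e₆ e₄))
  cases | _ | _ | _ | _ | _ | _ | fftt | fftt = ⊥-elim
    (alternating-corner sym-R distS altS (cycle-flip e₄) (cycle-flip e₆) d≢e (trans Nad (sym Nae)))

-- Pairwise linked alternating 4-cycles share a path u – w – v

record CommonPath (R : Mat m) (a b c d p q r s : Fin m) : Set where
  constructor common-path
  field
    u w v x₀ x₁ : Fin m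
    alt₀ : Alt R u w v x₀
    alt₁ : Alt R u w v x₁
    x₀≢x₁ : x₀ ≢ x₁
    same₀ : cycle a b c d ≐ cycle u w v x₀
    same₁ : cycle p q r s ≐ cycle u w v x₁

sharing-path⇒common-path : ∀ {R : Mat m} {a b c d p q r s : Fin m} → Symmetric R →
  Alt R a b c d → Alt R p q r s →
  cycle p q r s a b ≡ true → cycle p q r s b c ≡ true → cycle p q r s c d ≡ false →
  CommonPath R a b c d p q r s
sharing-path⇒common-path {R = R} {a} {b} {c} {d} sym-R altA@(distA , Eab , _) altS@(distS , _) e₁ e₂ e₃
  with cycle-path₂ distS e₁ e₂ (≢-sym (proj₁ (proj₂ distA)))
... | e , δ = common-path a b c d e altA altE d≢e (λ _ _ → refl) (cycle-dihedral δ)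
  where
  altE : Alt R a b c e
  altE = alternating⇒alt sym-R (distinct-dihedral δ distS)
           (alternating-dihedral sym-R δ (alt⇒alternating sym-R altS)) Eab
  d≢e : d ≢ e
  d≢e refl = true≢false (trans (cycle-dihedral δ c d) (side-cycle (proj₁ altE) rs)) e₃ refl

linked-triangle-common-path : ∀ {R : Mat m} {a b c d p q r s p′ q′ r′ s′ : Fin m} → Symmetric R →
  Alt R a b c d → Alt R p q r s → Alt R p′ q′ r′ s′ →
  Linked a b c d p q r s → Linked a b c d p′ q′ r′ s′ → Linked p q r s p′ q′ r′ s′ →
  CommonPath R a b c d p q r s
linked-triangle-common-path {R = R} {a} {b} {c} {d} {p} {q} {r} {s} sym-R
  altA@(distA , _) altS@(distS , _) altT@(distT , _) L₀₁ L₀₂ L₁₂ = cases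
  where
  via : ∀ {a′ b′ c′ d′} → Dihedral a b c d a′ b′ c′ d′ → CommonPath R a′ b′ c′ d′ p q r s →
        CommonPath R a b c d p q r s
  via δ (common-path u w v x₀ x₁ alt₀ alt₁ x₀≢x₁ same₀ same₁) =
    common-path u w v x₀ x₁ alt₀ alt₁ x₀≢x₁ (λ i j → trans (cycle-dihedral δ i j) (same₀ i j)) same₁

  crossed : ∀ {a′ b′ c′ d′} → Dihedral a b c d a′ b′ c′ d′ → Dihedral p q r s a′ b′ d′ c′ → ⊥
  crossed δ δ′ = crossed-linked-impossible sym-R (distinct-dihedral δ distA)
    (alternating-dihedral sym-R δ (alt⇒alternating sym-R altA))
    (alternating-dihedral sym-R δ′ (alt⇒alternating sym-R altS))
    distT (alt⇒alternating sym-R altT)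
    (linked-congˡ (cycle-dihedral δ) L₀₂) (linked-congˡ (cycle-dihedral δ′) L₁₂)

  cases : CommonPath R a b c d p q r s
  cases
    with cycle p q r s a b in e₁ | cycle p q r s b c in e₂ | cycle p q r s c d in e₃ | cycle p q r s d a in e₄
       | linked-shared-sides distA distS L₀₁
  ... | _ | _ | _ | _ | ttff = sharing-path⇒common-path sym-R altA altS e₁ e₂ e₃
  ... | _ | _ | _ | _ | fttf = via ref₃ (sharing-path⇒common-path sym-R
    (alt-reflect sym-R (alt-rotate₂ sym-R altA)) altS (cycle-flip e₃) (cycle-flip e₂) (cycle-flip e₁))
  ... | _ | _ | _ | _ | fftt = via rot₂ (sharing-path⇒common-path sym-R
    (alt-rotate₂ sym-R altA) altS e₃ e₄ e₁)
  ... | _ | _ | _ | _ | tfft = via ref₁ (sharing-path⇒common-path sym-R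
    (alt-reflect sym-R altA) altS (cycle-flip e₁) (cycle-flip e₄) (cycle-flip e₃))
  ... | _ | _ | _ | _ | tftf with cycle-opposite distA distS e₁ e₃
  ...   | inj₁ δ = ⊥-elim (true≢false (trans (cycle-dihedral δ b c) (side-cycle distA qr)) e₂ refl)
  ...   | inj₂ δ = ⊥-elim (crossed rot₀ δ)
  cases | _ | _ | _ | _ | ftft with cycle-opposite (distinct-dihedral rot₁ distA) distS e₂ e₄
  ...   | inj₁ δ = ⊥-elim
    (true≢false (trans (cycle-dihedral δ c d) (side-cycle (distinct-dihedral rot₁ distA) qr)) e₃ refl)
  ...   | inj₂ δ = ⊥-elim (crossed rot₁ δ)

common-path-extends : ∀ {R : Mat m} {a b c d p q r s p′ q′ r′ s′ : Fin m} → Symmetric R →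
  (C : CommonPath R a b c d p q r s) → Alt R p′ q′ r′ s′ →
  Linked a b c d p′ q′ r′ s′ → Linked p q r s p′ q′ r′ s′ →
  let open CommonPath C in ∃[ x ] Alt R u w v x × cycle p′ q′ r′ s′ ≐ cycle u w v x
common-path-extends sym-R (common-path u w v x₀ x₁ alt₀ alt₁ x₀≢x₁ same₀ same₁) altS@(distS , _)
  L₀ L₁ =
  linked-extends-path sym-R alt₀ alt₁ x₀≢x₁ distS (alt⇒alternating sym-R altS)
    (linked-congˡ same₀ L₀) (linked-congˡ same₁ L₁)

record FamilyPath (R : Mat m) {k : ℕ} (p q r s : Fin k → Fin m) : Set where
  field
    u w v : Fin m
    x : Fin k → Fin m
    alt : ∀ j → Alt R u w v (x j)
    same : ∀ j → cycle (p j) (q j) (r j) (s j) ≐ cycle u w v (x j)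

opaque
  family-common-path : ∀ {R : Mat m} {n} → Symmetric R → (p q r s : Fin (3 + n) → Fin m) →
    (∀ j → Alt R (p j) (q j) (r j) (s j)) →
    (∀ j k → j ≢ k → Linked (p j) (q j) (r j) (s j) (p k) (q k) (r k) (s k)) →
    FamilyPath R p q r s
  family-common-path {R = R} {n} sym-R p q r s alt link = record
    { u = u ; w = w ; v = v ; x = λ j → proj₁ (member j)
    ; alt = λ j → proj₁ (proj₂ (member j)) ; same = λ j → proj₂ (proj₂ (member j)) }
    where
    C : CommonPath R (p (# 0)) (q (# 0)) (r (# 0)) (s (# 0)) (p (# 1)) (q (# 1)) (r (# 1)) (s (# 1))
    C = linked-triangle-common-path sym-R (alt (# 0)) (alt (# 1)) (alt (# 2))
          (link (# 0) (# 1) (λ ())) (link (# 0) (# 2) (λ ())) (link (# 1) (# 2) (λ ()))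
    open CommonPath C
    member : ∀ j → ∃[ x ] Alt R u w v x × cycle (p j) (q j) (r j) (s j) ≐ cycle u w v x
    member zero = x₀ , alt₀ , same₀
    member (suc zero) = x₁ , alt₁ , same₁
    member (suc (suc j)) = common-path-extends sym-R C (alt (suc (suc j)))
      (link (# 0) (suc (suc j)) (λ ())) (link (# 1) (suc (suc j)) (λ ()))

-- A 2-switch adds its alternating 4-cycle to the adjacency matrix

vec-ext : ∀ {X : Set} {n} {xs ys : Vec X n} → (∀ j → lookup xs j ≡ lookup ys j) → xs ≡ ys
vec-ext {xs = xs} {ys} eq = trans (sym (tabulate∘lookup xs)) (trans (tabulate-cong eq) (tabulate∘lookup ys))

mat-ext : {A B : Mat m} → entry A ≐ entry B → A ≡ B
mat-ext eq = vec-ext (λ i → vec-ext (eq i))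

entry-switch : (A : Mat m) (p q r s i j : Fin m) → entry (switch A p q r s) i j ≡
  (if samePair i j p q ∨ samePair i j r s then false
   else if samePair i j p s ∨ samePair i j q r then true else entry A i j)
entry-switch A p q r s i j = trans (cong (λ row → lookup row j) (lookup∘tabulate _ i)) (lookup∘tabulate _ j)

opaque
  unfolding cycle

  cycle-off-sides : samePair i j p q ≡ false → samePair i j q r ≡ false → samePair i j r s ≡ false →
    samePair i j s p ≡ false → cycle p q r s i j ≡ false
  cycle-off-sides h₁ h₂ h₃ h₄ = cong₂ _xor_ h₁ (cong₂ _xor_ h₂ (cong₂ _xor_ h₃ h₄))

cycle-on-side : {A : Mat m} → Symmetric A → Distinct4 p q r s → Side p q r s a b → Side p q r s b a →
  samePair i j a b ≡ true → cycle p q r s i j xor entry A i j ≡ not (entry A a b)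
cycle-on-side {a = a} {b} {i = i} {j} sym-A dist σ σ′ h with samePair-true {i = i} {j} {a} {b} h
... | inj₁ (refl , refl) = cong (_xor _) (side-cycle dist σ)
... | inj₂ (refl , refl) = cong₂ _xor_ (side-cycle dist σ′) (entry-sym sym-A b a)

switch-entry : {A : Mat m} → Symmetric A → Alt A p q r s →
  entry (switch A p q r s) ≐ (λ i j → cycle p q r s i j xor entry A i j)
switch-entry {p = p} {q} {r} {s} {A} sym-A (dist , Epq , Ers , Nps , Nqr) i j
  rewrite entry-switch A p q r s i j with samePair i j p q in h₁
... | true = sym (trans (cycle-on-side sym-A dist pq qp h₁) (cong not Epq))
... | false with samePair i j r s in h₃
...   | true = sym (trans (cycle-on-side sym-A dist rs sr h₃) (cong not Ers))
...   | false with samePair i j p s in h₄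
...     | true = sym (trans (cycle-on-side sym-A dist ps sp h₄) (cong not Nps))
...     | false with samePair i j q r in h₂
...       | true = sym (trans (cycle-on-side sym-A dist qr rq h₂) (cong not Nqr))
...       | false = cong (_xor entry A i j)
                      (sym (cycle-off-sides h₁ h₂ h₃ (trans (samePair-comm i j s p) h₄)))

simple⇒symmetric : {A : Mat m} → IsSimple A → Symmetric A
simple⇒symmetric (sym-A , _) = symmetric sym-A

switch-simple : {A : Mat m} → IsSimple A → Alt A p q r s → IsSimple (switch A p q r s)
switch-simple {p = p} {q} {r} {s} {A} simple@(sym-A , loopless) alt@((p≢q , _ , p≢s , q≢r , _ , r≢s) , _) =
  (λ i j → begin
     entry (switch A p q r s) i j        ≡⟨ switch-entry symA alt i j ⟩
     cycle p q r s i j xor entry A i j  ≡⟨ cong₂ _xor_ (cycle-sym p q r s i j) (sym-A i j) ⟩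
     cycle p q r s j i xor entry A j i  ≡⟨ sym (switch-entry symA alt j i) ⟩
     entry (switch A p q r s) j i       ∎)
  , λ i → trans (switch-entry symA alt i i)
      (cong₂ _xor_ (cycle-off-sides (samePair-loop p≢q i) (samePair-loop q≢r i) (samePair-loop r≢s i)
                                    (samePair-loop (≢-sym p≢s) i))
                   (loopless i))
  where
  open ≡-Reasoning
  symA : Symmetric A
  symA = simple⇒symmetric simple

countTrue-raise : ∀ {n} (xs ys : Vec Bool n) (k : Fin n) → lookup xs k ≡ false → lookup ys k ≡ true →
  (∀ j → j ≢ k → lookup ys j ≡ lookup xs j) → countTrue ys ≡ suc (countTrue xs)
countTrue-raise (x ∷ xs) (y ∷ ys) zero refl refl rest =
  cong (λ zs → suc (countTrue zs)) (vec-ext {xs = ys} {xs} (λ j → rest (suc j) (λ ())))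
countTrue-raise (x ∷ xs) (true ∷ ys) (suc k) hx hy rest with rest zero (λ ())
... | refl = cong suc (countTrue-raise xs ys k hx hy (λ j j≢k → rest (suc j) (j≢k ∘ suc-injective)))
countTrue-raise (x ∷ xs) (false ∷ ys) (suc k) hx hy rest with rest zero (λ ())
... | refl = countTrue-raise xs ys k hx hy (λ j j≢k → rest (suc j) (j≢k ∘ suc-injective))

countTrue-exchange : ∀ {n} (xs ys : Vec Bool n) (k l : Fin n) → k ≢ l →
  lookup xs k ≡ true → lookup ys k ≡ false → lookup xs l ≡ false → lookup ys l ≡ true →
  (∀ j → j ≢ k → j ≢ l → lookup ys j ≡ lookup xs j) → countTrue ys ≡ countTrue xs
countTrue-exchange (x ∷ xs) (y ∷ ys) zero zero k≢l _ _ _ _ _ = ⊥-elim (k≢l refl)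
countTrue-exchange (x ∷ xs) (y ∷ ys) zero (suc l) _ refl refl hx hy rest =
  countTrue-raise xs ys l hx hy (λ j j≢l → rest (suc j) (λ ()) (j≢l ∘ suc-injective))
countTrue-exchange (x ∷ xs) (y ∷ ys) (suc k) zero _ hx hy refl refl rest =
  sym (countTrue-raise ys xs k hy hx (λ j j≢k → sym (rest (suc j) (j≢k ∘ suc-injective) (λ ()))))
countTrue-exchange (x ∷ xs) (true ∷ ys) (suc k) (suc l) k≢l hx hy hx′ hy′ rest with rest zero (λ ()) (λ ())
... | refl = cong suc (countTrue-exchange xs ys k l (k≢l ∘ cong suc) hx hy hx′ hy′
                         (λ j j≢k j≢l → rest (suc j) (j≢k ∘ suc-injective) (j≢l ∘ suc-injective)))
countTrue-exchange (x ∷ xs) (false ∷ ys) (suc k) (suc l) k≢l hx hy hx′ hy′ rest with rest zero (λ ()) (λ ())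
... | refl = countTrue-exchange xs ys k l (k≢l ∘ cong suc) hx hy hx′ hy′
               (λ j j≢k j≢l → rest (suc j) (j≢k ∘ suc-injective) (j≢l ∘ suc-injective))

switch-off-cycle : {A : Mat m} → Symmetric A → Alt A p q r s →
  cycle p q r s i j ≡ false → entry (switch A p q r s) i j ≡ entry A i j
switch-off-cycle {i = i} {j = j} sym-A alt h = trans (switch-entry sym-A alt i j) (cong (_xor _) h)

switch-on-cycle : {A : Mat m} → Symmetric A → Alt A p q r s → Side p q r s i j →
  entry (switch A p q r s) i j ≡ not (entry A i j)
switch-on-cycle {i = i} {j = j} sym-A alt@(dist , _) σ =
  trans (switch-entry sym-A alt i j) (cong (_xor _) (side-cycle dist σ))

switch-degree-first : {A : Mat m} → IsSimple A → Alt A p q r s → degree (switch A p q r s) p ≡ degree A p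
switch-degree-first {p = p} {q} {r} {s} {A} simple alt@(dist@(_ , _ , _ , _ , q≢s , _) , Epq , _ , Nps , _) =
  countTrue-exchange (lookup A p) (lookup (switch A p q r s) p) q s q≢s Epq
    (trans (switch-on-cycle symA alt pq) (cong not Epq)) Nps
    (trans (switch-on-cycle symA alt ps) (cong not Nps)) rest
  where
  symA : Symmetric A
  symA = simple⇒symmetric simple
  rest : ∀ j → j ≢ q → j ≢ s → entry (switch A p q r s) p j ≡ entry A p j
  rest j j≢q j≢s with cycle p q r s p j in h
  ... | true = ⊥-elim (j≢s (sym (cycle-prev dist h j≢q)))
  ... | false = switch-off-cycle symA alt h

switch-dihedral : {A : Mat m} → Symmetric A → Alt A p q r s → Alt A a b c d → Dihedral p q r s a b c d →
  switch A p q r s ≡ switch A a b c d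
switch-dihedral sym-A alt alt′ δ = mat-ext λ i j →
  trans (switch-entry sym-A alt i j)
        (trans (cong (_xor _) (cycle-dihedral δ i j)) (sym (switch-entry sym-A alt′ i j)))

switch-degree-corner : {A : Mat m} → IsSimple A → Alt A p q r s → Alt A a b c d →
  Dihedral p q r s a b c d → degree (switch A p q r s) a ≡ degree A a
switch-degree-corner {a = a} {A = A} simple alt alt′ δ =
  trans (cong (λ M → degree M a) (switch-dihedral {A = A} (simple⇒symmetric simple) alt alt′ δ))
        (switch-degree-first {A = A} simple alt′)

switch-degree : {A : Mat m} → IsSimple A → Alt A p q r s → ∀ x → degree (switch A p q r s) x ≡ degree A x
switch-degree {p = p} {q} {r} {s} {A} simple alt x
  with simple⇒symmetric {A = A} simple | x ≟ p | x ≟ q | x ≟ r | x ≟ s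
... | _    | yes refl | _ | _ | _ = switch-degree-first {A = A} simple alt
... | symA | no _ | yes refl | _ | _ = switch-degree-corner {A = A} simple alt (alt-reflect symA alt) ref₁
... | symA | no _ | no _ | yes refl | _ = switch-degree-corner {A = A} simple alt (alt-rotate₂ symA alt) rot₂
... | symA | no _ | no _ | no _ | yes refl =
  switch-degree-corner {A = A} simple alt (alt-reflect symA (alt-rotate₂ symA alt)) ref₃
... | symA | no x≢p | no x≢q | no x≢r | no x≢s =
  cong countTrue (vec-ext {xs = lookup (switch A p q r s) x} {lookup A x} λ j →
    switch-off-cycle {A = A} symA alt (cycle-avoidˡ {j = j} x≢p x≢q x≢r x≢s))

switch-realization : ∀ {ds : Vec ℕ m} {A : Mat m} → Realization ds A → Alt A p q r s →
  Realization ds (switch A p q r s)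
switch-realization {A = A} (simple , degrees) alt =
  switch-simple {A = A} simple alt , λ x → trans (switch-degree {A = A} simple alt x) (degrees x)

-- Neighbours of a realization in the realization graph

xor-cancelʳ : ∀ {x y} z → x xor z ≡ y xor z → x ≡ y
xor-cancelʳ {true} {true} _ _ = refl
xor-cancelʳ {false} {false} _ _ = refl
xor-cancelʳ {true} {false} true ()
xor-cancelʳ {true} {false} false ()
xor-cancelʳ {false} {true} true ()
xor-cancelʳ {false} {true} false ()

xor-moveˡ : ∀ {x y} z → x ≡ z xor y → y ≡ z xor x
xor-moveˡ true refl = sym (not-involutive _)
xor-moveˡ false refl = refl

record NeighbourCycle (R M : Mat m) : Set where
  constructor neighbour-cycle
  field
    c₁ c₂ c₃ c₄ : Fin m
    alt : Alt R c₁ c₂ c₃ c₄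
    entries : entry M ≐ λ i j → cycle c₁ c₂ c₃ c₄ i j xor entry R i j

switched-back : ∀ {R M : Mat m} → IsSimple M → Alt M p q r s → R ≡ switch M p q r s →
  NeighbourCycle R M
switched-back {p = p} {q} {r} {s} {R} {M} simple altM@(dist , Epq , Ers , Nps , Nqr) refl =
  neighbour-cycle p s r q altR
    (λ i j → trans (xor-moveˡ (cycle p q r s i j) (switch-entry symM altM i j))
                   (cong (_xor entry (switch M p q r s) i j) (cycle-reflect p q r s i j)))
  where
  symM : Symmetric M
  symM = simple⇒symmetric simple
  altR : Alt (switch M p q r s) p s r q
  altR = distinct-dihedral ref₀ dist
       , trans (switch-on-cycle symM altM ps) (cong not Nps)
       , trans (switch-on-cycle symM altM rq) (cong not (trans (entry-sym symM r q) Nqr))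
       , trans (switch-on-cycle symM altM pq) (cong not Epq)
       , trans (switch-on-cycle symM altM sr) (cong not (trans (entry-sym symM s r) Ers))

adjacent⇒neighbour-cycle : ∀ {R M : Mat m} → IsSimple R → IsSimple M → Adjacent R M → NeighbourCycle R M
adjacent⇒neighbour-cycle {R = R} simpleR _ (inj₁ (p , q , r , s , alt , refl)) =
  neighbour-cycle p q r s alt (switch-entry {A = R} (simple⇒symmetric simpleR) alt)
adjacent⇒neighbour-cycle {M = M} _ simpleM (inj₂ (p , q , r , s , alt , eq)) =
  switched-back {M = M} simpleM alt eq

adjacent-difference : ∀ {M₁ M₂ : Mat m} → IsSimple M₁ → IsSimple M₂ → Adjacent M₁ M₂ →
  ∃[ t₁ ] ∃[ t₂ ] ∃[ t₃ ] ∃[ t₄ ] Distinct4 t₁ t₂ t₃ t₄ ×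
    entry M₂ ≐ λ i j → cycle t₁ t₂ t₃ t₄ i j xor entry M₁ i j
adjacent-difference s₁ s₂ adj with adjacent⇒neighbour-cycle s₁ s₂ adj
... | neighbour-cycle p q r s (dist , _) entries = p , q , r , s , dist , entries

neighbours-linked : ∀ {R M₁ M₂ : Mat m} → IsSimple M₁ → IsSimple M₂ →
  (n₁ : NeighbourCycle R M₁) (n₂ : NeighbourCycle R M₂) → Adjacent M₁ M₂ →
  let module n₁ = NeighbourCycle n₁; module n₂ = NeighbourCycle n₂ in
  Linked n₁.c₁ n₁.c₂ n₁.c₃ n₁.c₄ n₂.c₁ n₂.c₂ n₂.c₃ n₂.c₄
neighbours-linked {R = R} {M₁} {M₂} s₁ s₂ n₁ n₂ adj with adjacent-difference s₁ s₂ adj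
... | t₁ , t₂ , t₃ , t₄ , dist , step = linked t₁ t₂ t₃ t₄ dist λ i j →
  xor-cancelʳ (entry R i j) (begin
    C₂ i j xor entry R i j              ≡⟨ sym (n₂.entries i j) ⟩
    entry M₂ i j                        ≡⟨ step i j ⟩
    T i j xor entry M₁ i j              ≡⟨ cong (T i j xor_) (n₁.entries i j) ⟩
    T i j xor (C₁ i j xor entry R i j)  ≡⟨ solve 3 (λ t c r → t ⊕ (c ⊕ r) ⊜ (c ⊕ t) ⊕ r) refl
                                                  (T i j) (C₁ i j) (entry R i j) ⟩
    (C₁ i j xor T i j) xor entry R i j  ∎)
  where
  open ≡-Reasoning
  module n₁ = NeighbourCycle n₁
  module n₂ = NeighbourCycle n₂
  C₁ C₂ T : Fin _ → Fin _ → Bool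
  C₁ = cycle n₁.c₁ n₁.c₂ n₁.c₃ n₁.c₄
  C₂ = cycle n₂.c₁ n₂.c₂ n₂.c₃ n₂.c₄
  T = cycle t₁ t₂ t₃ t₄

D-edge D-nonedge : ∀ n → Fin n → Fin (2 + n) × Fin (2 + n)
D-edge n i = if isZero i then (zero , suc (suc i)) else (suc zero , suc (suc i))
D-nonedge n i = if isZero i then (suc zero , suc (suc i)) else (zero , suc (suc i))

module _ {X : Set} {P : X → Set} {n : ℕ} {g : Fin n → X} where

  all-allFin⁺ : (∀ i → P (g i)) → All P (map g (allFin n))
  all-allFin⁺ h = Allₚ.map⁺ (Allₚ.tabulate⁺ h)

  all-allFin⁻ : All P (map g (allFin n)) → ∀ i → P (g i)
  all-allFin⁻ h = Allₚ.tabulate⁻ (Allₚ.map⁻ h)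

  any-allFin⁺ : ∀ i → P (g i) → Any P (map g (allFin n))
  any-allFin⁺ i h = Anyₚ.map⁺ (Anyₚ.tabulate⁺ i h)

  any-allFin⁻ : Any P (map g (allFin n)) → ∃[ i ] P (g i)
  any-allFin⁻ h = Anyₚ.tabulate⁻ (Anyₚ.map⁻ h)

-- A copy of 𝒟ₙ in R yields a clique of size n containing R

module FromConfiguration {ds : Vec ℕ m} {R : Mat m} (realR : Realization ds R) {n : ℕ}
                         (emb : Embedding R (D (suc n))) where
  open Embedding emb

  u v w : Fin m
  u = f zero
  v = f (suc zero)
  w = f (suc (suc zero))

  y : Fin n → Fin m
  y j = f (suc (suc (suc j)))

  symR : Symmetric R
  symR = simple⇒symmetric (proj₁ realR)

  f-≢ : ∀ {a b} → a ≢ b → f a ≢ f b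
  f-≢ a≢b = a≢b ∘ inj _ _

  y-≢ : ∀ {j k} → j ≢ k → y j ≢ y k
  y-≢ j≢k = f-≢ (j≢k ∘ suc-injective ∘ suc-injective ∘ suc-injective)

  Euw : E R u w
  Euw = all-allFin⁻ edges zero

  Evy : ∀ j → E R v (y j)
  Evy j = all-allFin⁻ edges (suc j)

  Nvw : NE R v w
  Nvw = all-allFin⁻ nonedges zero

  Nuy : ∀ j → NE R u (y j)
  Nuy j = all-allFin⁻ nonedges (suc j)

  distinct : ∀ j → Distinct4 u w v (y j)
  distinct j = f-≢ (λ ()) , f-≢ (λ ()) , f-≢ (λ ()) , f-≢ (λ ()) , f-≢ (λ ()) , f-≢ (λ ())

  alt : ∀ j → Alt R u w v (y j)
  alt j = distinct j , Euw , Evy j , Nuy j , trans (entry-sym symR w v) Nvw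

  K : Fin (suc n) → Mat m
  K zero = R
  K (suc j) = switch R u w v (y j)

  K-entries : ∀ j → entry (K (suc j)) ≐ λ i k → cycle u w v (y j) i k xor entry R i k
  K-entries j = switch-entry {A = R} symR (alt j)

  K-off : ∀ {j k} → j ≢ k → ∀ a → entry (K (suc j)) a (y k) ≡ entry R a (y k)
  K-off {j} {k} j≢k a = trans (K-entries j a (y k)) (cong (_xor entry R a (y k))
    (cycle-avoidʳ (f-≢ (λ ())) (f-≢ (λ ())) (f-≢ (λ ())) (y-≢ (j≢k ∘ sym))))

  uw-switched : ∀ j → entry (K (suc j)) u w ≡ false
  uw-switched j = trans (switch-on-cycle {A = R} symR (alt j) pq) (cong not Euw)

  uy-switched : ∀ j → entry (K (suc j)) u (y j) ≡ true
  uy-switched j = trans (switch-on-cycle {A = R} symR (alt j) ps) (cong not (Nuy j))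

  K-distinct : ∀ i k → i ≢ k → K i ≢ K k
  K-distinct zero zero i≢k _ = i≢k refl
  K-distinct zero (suc k) _ R≡K = true≢false Euw (uw-switched k) (cong (λ M → entry M u w) R≡K)
  K-distinct (suc j) zero _ K≡R = true≢false Euw (uw-switched j) (cong (λ M → entry M u w) (sym K≡R))
  K-distinct (suc j) (suc k) j≢k K≡K = true≢false (uy-switched j)
    (trans (K-off (j≢k ∘ cong suc ∘ sym) u) (Nuy j)) (cong (λ M → entry M u (y j)) K≡K)

  realizations : ∀ i → Realization ds (K i)
  realizations zero = realR
  realizations (suc j) = switch-realization {ds = ds} {A = R} realR (alt j)

  step-alt : ∀ {j k} → j ≢ k → Alt (K (suc j)) u (y j) v (y k)
  step-alt {j} {k} j≢k =
    (f-≢ (λ ()) , f-≢ (λ ()) , f-≢ (λ ()) , f-≢ (λ ()) , y-≢ j≢k , f-≢ (λ ()))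
    , uy-switched j
    , trans (K-off j≢k v) (Evy k)
    , trans (K-off j≢k u) (Nuy k)
    , trans (switch-on-cycle {A = R} symR (alt j) sr) (cong not (trans (entry-sym symR (y j) v) (Evy j)))

  step : ∀ {j k} → j ≢ k → K (suc k) ≡ switch (K (suc j)) u (y j) v (y k)
  step {j} {k} j≢k = mat-ext λ a b → begin
    entry (K (suc k)) a b
      ≡⟨ K-entries k a b ⟩
    cycle u w v (y k) a b xor entry R a b
      ≡⟨ cong (_xor entry R a b) (cycle-glue u w v (y j) (y k) a b) ⟩
    (cycle u (y j) v (y k) a b xor cycle u w v (y j) a b) xor entry R a b
      ≡⟨ xor-assoc (cycle u (y j) v (y k) a b) _ _ ⟩
    cycle u (y j) v (y k) a b xor (cycle u w v (y j) a b xor entry R a b)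
      ≡⟨ cong (cycle u (y j) v (y k) a b xor_) (sym (K-entries j a b)) ⟩
    cycle u (y j) v (y k) a b xor entry (K (suc j)) a b
      ≡⟨ sym (switch-entry {A = K (suc j)} (simple⇒symmetric (proj₁ (realizations (suc j))))
                          (step-alt j≢k) a b) ⟩
    entry (switch (K (suc j)) u (y j) v (y k)) a b ∎
    where open ≡-Reasoning

  K-adjacent : ∀ i k → i ≢ k → Adjacent (K i) (K k)
  K-adjacent zero zero i≢k = ⊥-elim (i≢k refl)
  K-adjacent zero (suc k) _ = inj₁ (u , w , v , y k , alt k , refl)
  K-adjacent (suc j) zero _ = inj₂ (u , w , v , y j , alt j , refl)
  K-adjacent (suc j) (suc k) j≢k =
    inj₁ (u , y j , v , y k , step-alt (j≢k ∘ cong suc) , step (j≢k ∘ cong suc))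

  clique : InClique ds R (suc n)
  clique = K , (realizations , K-distinct , K-adjacent) , zero , refl

-- A clique of size n ≥ 4 through R yields a copy of 𝒟ₙ in R

∷-injective : ∀ {X : Set} {k} {a : X} {g : Fin k → X} →
  (∀ i → g i ≢ a) → (∀ i j → g i ≡ g j → i ≡ j) →
  ∀ i j → (a ∷ᶠ g) i ≡ (a ∷ᶠ g) j → i ≡ j
∷-injective _ _ zero zero _ = refl
∷-injective avoid _ zero (suc j) eq = ⊥-elim (avoid j (sym eq))
∷-injective avoid _ (suc i) zero eq = ⊥-elim (avoid i eq)
∷-injective _ inj (suc i) (suc j) eq = cong suc (inj i j eq)

module FromClique {ds : Vec ℕ m} {R : Mat m} (realR : Realization ds R) {n : ℕ}
                  (K : Fin (4 + n) → Mat m) (clique : IsClique ds (4 + n) K)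
                  (i₀ : Fin (4 + n)) (K-i₀ : K i₀ ≡ R) where

  symR : Symmetric R
  symR = simple⇒symmetric (proj₁ realR)

  M : Fin (3 + n) → Mat m
  M j = K (punchIn i₀ j)

  simpleM : ∀ j → IsSimple (M j)
  simpleM j = proj₁ (proj₁ clique (punchIn i₀ j))

  adjacentM : ∀ j k → j ≢ k → Adjacent (M j) (M k)
  adjacentM j k j≢k = proj₂ (proj₂ clique) _ _ (j≢k ∘ punchIn-injective i₀ j k)

  neighbour : ∀ j → NeighbourCycle R (M j)
  neighbour j = adjacent⇒neighbour-cycle (proj₁ realR) (simpleM j)
    (subst (λ X → Adjacent X (M j)) K-i₀ (proj₂ (proj₂ clique) i₀ _ (≢-sym (punchInᵢ≢i i₀ j))))

  c₁ c₂ c₃ c₄ : Fin (3 + n) → Fin m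
  c₁ j = NeighbourCycle.c₁ (neighbour j)
  c₂ j = NeighbourCycle.c₂ (neighbour j)
  c₃ j = NeighbourCycle.c₃ (neighbour j)
  c₄ j = NeighbourCycle.c₄ (neighbour j)

  path : FamilyPath R c₁ c₂ c₃ c₄
  path = family-common-path symR c₁ c₂ c₃ c₄ (λ j → NeighbourCycle.alt (neighbour j))
    (λ j k j≢k → neighbours-linked (simpleM j) (simpleM k) (neighbour j) (neighbour k) (adjacentM j k j≢k))

  open FamilyPath path

  M-switch : ∀ j → M j ≡ switch R u w v (x j)
  M-switch j = mat-ext λ a b →
    trans (NeighbourCycle.entries (neighbour j) a b)
          (trans (cong (_xor entry R a b) (same j a b)) (sym (switch-entry symR (alt j) a b)))

  M-distinct : ∀ j k → j ≢ k → M j ≢ M k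
  M-distinct j k j≢k =
    proj₁ (proj₂ clique) (punchIn i₀ j) (punchIn i₀ k) (j≢k ∘ punchIn-injective i₀ j k)

  x-injective : ∀ j k → x j ≡ x k → j ≡ k
  x-injective j k eq = decidable-stable (j ≟ k) λ j≢k →
    M-distinct j k j≢k (trans (M-switch j) (trans (cong (switch R u w v) eq) (sym (M-switch k))))

  u≢w : u ≢ w
  u≢w = let (u≢w , _ , _ , _ , _ , _) = proj₁ (alt (# 0)) in u≢w
  u≢v : u ≢ v
  u≢v = let (_ , u≢v , _ , _ , _ , _) = proj₁ (alt (# 0)) in u≢v
  w≢v : w ≢ v
  w≢v = let (_ , _ , _ , w≢v , _ , _) = proj₁ (alt (# 0)) in w≢v
  u≢x : ∀ j → u ≢ x j
  u≢x j = let (_ , _ , u≢x , _ , _ , _) = proj₁ (alt j) in u≢x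
  w≢x : ∀ j → w ≢ x j
  w≢x j = let (_ , _ , _ , _ , w≢x , _) = proj₁ (alt j) in w≢x
  v≢x : ∀ j → v ≢ x j
  v≢x j = let (_ , _ , _ , _ , _ , v≢x) = proj₁ (alt j) in v≢x

  f : Fin (2 + (4 + n)) → Fin m
  f = u ∷ᶠ v ∷ᶠ w ∷ᶠ x

  f-injective : ∀ a b → f a ≡ f b → a ≡ b
  f-injective = ∷-injective u-fresh (∷-injective v-fresh (∷-injective (λ j → ≢-sym (w≢x j)) x-injective))
    where
    u-fresh : ∀ i → (v ∷ᶠ w ∷ᶠ x) i ≢ u
    u-fresh zero = ≢-sym u≢v
    u-fresh (suc zero) = ≢-sym u≢w
    u-fresh (suc (suc j)) = ≢-sym (u≢x j)
    v-fresh : ∀ i → (w ∷ᶠ x) i ≢ v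
    v-fresh zero = w≢v
    v-fresh (suc j) = ≢-sym (v≢x j)

  embedding : Embedding R (D (4 + n))
  embedding = record
    { f = f
    ; inj = f-injective
    ; edges = all-allFin⁺ {P = λ e → E R (f (proj₁ e)) (f (proj₂ e))} {g = D-edge (4 + n)} edge
    ; nonedges = all-allFin⁺ {P = λ e → NE R (f (proj₁ e)) (f (proj₂ e))} {g = D-nonedge (4 + n)} nonedge
    }
    where
    edge : ∀ i → E R (f (proj₁ (D-edge (4 + n) i))) (f (proj₂ (D-edge (4 + n) i)))
    edge zero = let (_ , Euw , _) = alt (# 0) in Euw
    edge (suc j) = let (_ , _ , Evx , _) = alt j in Evx
    nonedge : ∀ i → NE R (f (proj₁ (D-nonedge (4 + n) i))) (f (proj₂ (D-nonedge (4 + n) i)))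
    nonedge zero = let (_ , _ , _ , _ , Nwv) = alt (# 0) in trans (entry-sym symR v w) Nwv
    nonedge (suc j) = let (_ , _ , _ , Nux , _) = alt j in Nux

  data EdgePair : Fin m → Fin m → Set where
    uw : EdgePair u w
    wu : EdgePair w u
    vx : ∀ j → EdgePair v (x j)
    xv : ∀ j → EdgePair (x j) v

  Joins : Fin m → Fin m → Fin (2 + (4 + n)) × Fin (2 + (4 + n)) → Set
  Joins a b e = (f (proj₁ e) ≡ a × f (proj₂ e) ≡ b) ⊎ (f (proj₁ e) ≡ b × f (proj₂ e) ≡ a)

  edge-pair : (∃[ i ] Joins a b (D-edge (4 + n) i)) → EdgePair a b
  edge-pair (zero , inj₁ (refl , refl)) = uw
  edge-pair (zero , inj₂ (refl , refl)) = wu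
  edge-pair (suc j , inj₁ (refl , refl)) = vx j
  edge-pair (suc j , inj₂ (refl , refl)) = xv j

  uv-not-nonedge : ¬ (∃[ i ] Joins u v (D-nonedge (4 + n) i))
  uv-not-nonedge (zero , inj₁ (v≡u , _)) = u≢v (sym v≡u)
  uv-not-nonedge (zero , inj₂ (_ , w≡u)) = u≢w (sym w≡u)
  uv-not-nonedge (suc j , inj₁ (_ , x≡v)) = v≢x j (sym x≡v)
  uv-not-nonedge (suc j , inj₂ (u≡v , _)) = u≢v u≡v

  wx-not-nonedge : ∀ k → ¬ (∃[ i ] Joins w (x k) (D-nonedge (4 + n) i))
  wx-not-nonedge k (zero , inj₁ (v≡w , _)) = w≢v (sym v≡w)
  wx-not-nonedge k (zero , inj₂ (v≡x , _)) = v≢x k v≡x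
  wx-not-nonedge k (suc j , inj₁ (u≡w , _)) = u≢w u≡w
  wx-not-nonedge k (suc j , inj₂ (u≡x , _)) = u≢x k u≡x

  switch-member : ∀ {a b c d B} j → Dihedral u w v (x j) a b c d → Alt R a b c d → B ≡ switch R a b c d →
    ∃[ i ] K i ≡ B
  switch-member j δ altA refl = punchIn i₀ j , trans (M-switch j) (switch-dihedral symR (alt j) altA δ)

  pairs-member : ∀ {a b c d B} → EdgePair a b → EdgePair c d → Alt R a b c d →
    (∃[ i ] Joins a d (D-nonedge (4 + n) i)) →
    B ≡ switch R a b c d → ∃[ i ] K i ≡ B
  pairs-member uw uw ((_ , a≢c , _) , _) _ _ = ⊥-elim (a≢c refl)
  pairs-member uw wu ((_ , _ , a≢d , _) , _) _ _ = ⊥-elim (a≢d refl)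
  pairs-member uw (vx j) altA _ eq = switch-member j rot₀ altA eq
  pairs-member uw (xv j) _ had _ = ⊥-elim (uv-not-nonedge had)
  pairs-member wu uw ((_ , _ , _ , b≢c , _) , _) _ _ = ⊥-elim (b≢c refl)
  pairs-member wu wu ((_ , a≢c , _) , _) _ _ = ⊥-elim (a≢c refl)
  pairs-member wu (vx j) _ had _ = ⊥-elim (wx-not-nonedge j had)
  pairs-member wu (xv j) altA _ eq = switch-member j ref₁ altA eq
  pairs-member (vx j) uw altA _ eq = switch-member j rot₂ altA eq
  pairs-member (vx j) wu _ had _ = ⊥-elim (uv-not-nonedge (map₂ swap had))
  pairs-member (vx j) (vx k) ((_ , a≢c , _) , _) _ _ = ⊥-elim (a≢c refl)
  pairs-member (vx j) (xv k) ((_ , _ , a≢d , _) , _) _ _ = ⊥-elim (a≢d refl)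
  pairs-member (xv j) uw _ had _ = ⊥-elim (wx-not-nonedge j (map₂ swap had))
  pairs-member (xv j) wu altA _ eq = switch-member j ref₃ altA eq
  pairs-member (xv j) (vx k) ((_ , _ , _ , b≢c , _) , _) _ _ = ⊥-elim (b≢c refl)
  pairs-member (xv j) (xv k) ((_ , _ , _ , _ , b≢d , _) , _) _ _ = ⊥-elim (b≢d refl)

  switch-within⇒member : ∀ {B} → SwitchWithin embedding B → ∃[ i ] K i ≡ B
  switch-within⇒member (_ , _ , _ , _ , altA , hab , hcd , had , _ , eq) =
    pairs-member (edge-pair (any-allFin⁻ hab)) (edge-pair (any-allFin⁻ hcd)) altA
                 (any-allFin⁻ {g = D-nonedge (4 + n)} had) eq

  neighbour-within : ∀ {i} → i₀ ≢ i → SwitchWithin embedding (K i)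
  neighbour-within i₀≢i = u , w , v , x j′ , alt j′
    , any-allFin⁺ zero (inj₁ (refl , refl)) , any-allFin⁺ (suc j′) (inj₁ (refl , refl))
    , any-allFin⁺ (suc j′) (inj₁ (refl , refl)) , any-allFin⁺ zero (inj₂ (refl , refl))
    , trans (cong K (sym (punchIn-punchOut i₀≢i))) (M-switch j′)
    where
    j′ : Fin (3 + n)
    j′ = punchOut i₀≢i

  member⇒switch-within : ∀ {B} → B ≢ R → ∃[ i ] K i ≡ B → SwitchWithin embedding B
  member⇒switch-within B≢R (i , refl) =
    neighbour-within λ i₀≡i → B≢R (trans (cong K (sym i₀≡i)) K-i₀)

  member⇔switch-within : ∀ B → B ≢ R → (∃[ i ] K i ≡ B) ⇔ SwitchWithin embedding B
  member⇔switch-within B B≢R = mk⇔ (member⇒switch-within B≢R) switch-within⇒member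


theorem6 : ∀ {m} (d : Vec ℕ m) (R : Mat m) (n : ℕ) → 4 ≤ n → Realization d R →
    (InClique d R n ⇔ Contains R (D n))
    × (∀ (K : Fin n → Mat m) → IsClique d n K → ∃[ i ] (K i ≡ R) →
        Σ (Embedding R (D n)) λ e →
          ∀ (B : Mat m) → B ≢ R → ((∃[ i ] (K i ≡ B)) ⇔ SwitchWithin e B))
theorem6 d R (suc (suc (suc (suc n)))) (s≤s (s≤s (s≤s (s≤s z≤n)))) realR =
  mk⇔ (λ (K , clique , i₀ , K-i₀) → FromClique.embedding {ds = d} realR K clique i₀ K-i₀)
      (FromConfiguration.clique {ds = d} realR)
  , λ K clique (i₀ , K-i₀) →
      let open FromClique {ds = d} realR K clique i₀ K-i₀ in embedding , member⇔switch-within
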